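{- Let $q$ be a power of an odd prime, let $\mathbb F$ be the field of order $q^2$, and let $a\in\mathbb F\setminus\{0,1\}$. Then $Q_{a,a^q}=(\mathbb F_{q^2},*_a)$ and $Q_{a^q,a}=(\mathbb F_{q^2},*_{a^q})$. Moreover, the map $x\mapsto x^q$ is an isomorphism $(\mathbb F_{q^2},*_a)\cong(\mathbb F_{q^2},*_{a^q})$.
   Context: $\chi$ is the quadratic character of $\mathbb F$. For $a,b\in\mathbb F$ with $\chi(a)=\chi(b)\ne0$ and $\chi(1-a)=\chi(1-b)\ne0$, $Q_{a,b}$ is $(\mathbb F,*)$ with $x*y=x+a(y-x)$ if $\chi(y-x)\ge0$ and $x*y=x+b(y-x)$ if $\chi(y-x)=-1$. The quadratic nearfield on $\mathbb F_{q^2}$ has the field addition and multiplication $x\circ y=xy$ if $\chi(x)\ge0$, $x\circ y=xy^q$ if $\chi(x)=-1$. For $c\in\mathbb F_{q^2}\setminus\{0,1\}$, $(\mathbb F_{q^2},*_c)$ is the quasigroup with $x*_cy=x+(y-x)\circ c$. -}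

module Defs where

open import Level using (Level; _⊔_) renaming (suc to lsuc)
open import Algebra.Bundles using (CommutativeRing)
open import Data.Nat using (ℕ; zero; suc; _^_; _≤_)
open import Data.Nat.Primality using (Prime)
open import Data.Fin using (Fin)
open import Data.Fin.Properties using (any?)
open import Data.Integer using (ℤ; 0ℤ; 1ℤ; -1ℤ) renaming (_≟_ to _≟ℤ_)
open import Data.Product using (Σ; ∃; _×_; _,_)
open import Relation.Nullary using (¬_; Dec; yes; no)
open import Relation.Binary.Core using (Rel)
open import Relation.Binary.Definitions using (Decidable)
open import Relation.Binary.PropositionalEquality using (_≡_)

OddPrimePower : ℕ → Set
OddPrimePower q = Σ ℕ λ p → Σ ℕ λ k → Prime p × ¬ (p ≡ 2) × 1 ≤ k × q ≡ p ^ k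

record FiniteField (c ℓ : Level) : Set (lsuc (c ⊔ ℓ)) where
  field
    commRing : CommutativeRing c ℓ
  open CommutativeRing commRing public
  field
    0≉1       : ¬ (0# ≈ 1#)
    inverse   : ∀ x → ¬ (x ≈ 0#) → ∃ λ y → x * y ≈ 1#
    _≟_       : Decidable _≈_
    size      : ℕ
    enum      : Fin size → Carrier
    enum-surj : ∀ x → ∃ λ i → enum i ≈ x
    enum-inj  : ∀ i j → enum i ≈ enum j → i ≡ j

module FieldOps {c ℓ : Level} (F : FiniteField c ℓ) where
  open FiniteField F

  pow : Carrier → ℕ → Carrier
  pow x zero    = 1#
  pow x (suc n) = x * pow x n

  IsSquare : Carrier → Set (c ⊔ ℓ)
  IsSquare x = ∃ λ y → y * y ≈ x

  isSquare? : ∀ x → Dec (IsSquare x)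
  isSquare? x with any? (λ i → (enum i * enum i) ≟ x)
  ... | yes (i , e) = yes (enum i , e)
  ... | no ¬e = no λ { (y , e) → helper y e }
    where
    helper : ∀ y → y * y ≈ x → _
    helper y e with enum-surj y
    ... | i , ei = ¬e (i , trans (*-cong ei ei) e)

  χ : Carrier → ℤ
  χ x with x ≟ 0#
  ... | yes _ = 0ℤ
  ... | no _ with isSquare? x
  ...   | yes _ = 1ℤ
  ...   | no _  = -1ℤ

  -- (a, b) satisfy the hypotheses needed to define Q_{a,b}:
  -- χ(a) = χ(b) ≠ 0 and χ(1-a) = χ(1-b) ≠ 0
  Admissible : Carrier → Carrier → Set
  Admissible a b = χ a ≡ χ b × ¬ (χ a ≡ 0ℤ) × χ (1# - a) ≡ χ (1# - b) × ¬ (χ (1# - a) ≡ 0ℤ)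

  Qop : Carrier → Carrier → Carrier → Carrier → Carrier
  Qop a b x y with χ (y - x) ≟ℤ -1ℤ
  ... | yes _ = x + b * (y - x)
  ... | no _  = x + a * (y - x)

  -- quadratic nearfield multiplication on F_{q^2} (q given explicitly):
  -- x ∘ y = x y if χ(x) ≥ 0, and x y^q if χ(x) = -1
  nearMul : ℕ → Carrier → Carrier → Carrier
  nearMul q x y with χ x ≟ℤ -1ℤ
  ... | yes _ = x * pow y q
  ... | no _  = x * y

  starOp : ℕ → Carrier → Carrier → Carrier → Carrier
  starOp q cc x y = x + nearMul q (y - x) cc

  SameOp : (Carrier → Carrier → Carrier) → (Carrier → Carrier → Carrier) → Set (c ⊔ ℓ)
  SameOp _∙_ _◦_ = ∀ x y → (x ∙ y) ≈ (x ◦ y)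

  IsIsomorphism : (Carrier → Carrier) → (Carrier → Carrier → Carrier) → (Carrier → Carrier → Carrier) → Set (c ⊔ ℓ)
  IsIsomorphism f _∙_ _◦_ =
    (∀ x y → x ≈ y → f x ≈ f y) ×
    (∀ x y → f x ≈ f y → x ≈ y) ×
    (∀ y → ∃ λ x → f x ≈ y) ×
    (∀ x y → f (x ∙ y) ≈ (f x ◦ f y))

{-# OPTIONS --safe #-}
-- In characteristic p the binomial theorem makes x ↦ x ^ p additive, so the map σ x = x ^ q is a
-- ring endomorphism of F. Translation by 1 and multiplication by x ≠ 0 permute F; the first gives
-- size · 1 = 0, hence characteristic p, the second x ^ (q * q) = x, so σ is an involutive automorphism. It
-- therefore preserves squares, hence χ, which gives the admissibility conditions for (a, a ^ q) and
-- makes σ commute with the nearfield product: σ (x *_a y) = σ x *_(σ a) σ y. That Q_{a,a^q} is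
-- (F, *_a) is immediate from the definitions, since d ∘ a = d a^q exactly when χ d = -1.
module Submission where

open import Algebra.Bundles using (CommutativeMonoid; CommutativeRing)
open import Data.Nat as ℕ using (ℕ; zero; suc)
import Data.Nat.Properties as ℕ
open import Data.Nat.Divisibility using (_∣_; divides)
open import Data.Nat.Primality using (Prime)
open import Data.Nat.Combinatorics using (_C_; nCn≡1)
open import Data.Fin as Fin using (Fin; zero; suc)
import Data.Fin.Properties as Fin
open import Data.Fin.Permutation using (Permutation; permutation)
open import Data.Integer using (0ℤ; -1ℤ) renaming (_≟_ to _≟ℤ_)
open import Data.Product using (_,_; proj₁; proj₂)
open import Data.Sum using (_⊎_; inj₁; inj₂; [_,_])
open import Function using (_∘_; id; _⇔_; mk⇔; Equivalence)
open import Relation.Nullary using (¬_; yes; no)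
open import Relation.Nullary.Negation using (contradiction)
import Relation.Binary.PropositionalEquality as ≡
import Algebra.Properties.CommutativeMonoid.Sum as Sum
open import Defs

module _ where
  open import Data.Nat
  open import Data.Nat.Properties
  open import Data.Nat.Divisibility
  open import Data.Nat.DivMod using (_/_; m/n*n≡m)
  open import Data.Nat.Primality
  open import Data.Nat.Combinatorics using (_C_; nCk≡n!/k![n-k]!; k![n∸k]!∣n!)
  open import Data.Sum using (inj₁; inj₂)
  open import Relation.Nullary.Negation using (contradiction)
  open import Relation.Binary.PropositionalEquality

  prime⇒1<p : ∀ {p} → Prime p → 1 < p
  prime⇒1<p {p} p-prime = nonTrivial⇒n>1 p {{prime⇒nonTrivial p-prime}}

  prime∤factorial : ∀ {p m} → Prime p → m < p → p ∤ m !
  prime∤factorial {m = zero} p-prime m<p p∣1 = <⇒≢ (prime⇒1<p p-prime) (sym (∣1⇒≡1 p∣1))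
  prime∤factorial {m = suc m} p-prime m<p p∣m! with euclidsLemma (suc m) (m !) p-prime p∣m!
  ... | inj₁ p∣1+m = <⇒≱ m<p (∣⇒≤ p∣1+m)
  ... | inj₂ p∣m!  = prime∤factorial p-prime (<-trans (n<1+n m) m<p) p∣m!

  prime∣binomial : ∀ {p k} → Prime p → 0 < k → k < p → p ∣ p C k
  prime∣binomial {p@(suc n)} {k} p-prime 0<k k<p
    with euclidsLemma (p C k) (k ! * (p ∸ k) !) p-prime p∣pCk*k!*[p-k]!
    where
    instance
      k!*[p-k]!≢0 : NonZero (k ! * (p ∸ k) !)
      k!*[p-k]!≢0 = k !* (p ∸ k) !≢0
    p∣pCk*k!*[p-k]! : p ∣ (p C k) * (k ! * (p ∸ k) !)
    p∣pCk*k!*[p-k]! = subst (p ∣_) (sym (begin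
      (p C k) * (k ! * (p ∸ k) !)               ≡⟨ cong (_* (k ! * (p ∸ k) !)) (nCk≡n!/k![n-k]! (<⇒≤ k<p)) ⟩
      (p ! / (k ! * (p ∸ k) !)) * (k ! * (p ∸ k) !) ≡⟨ m/n*n≡m (k![n∸k]!∣n! (<⇒≤ k<p)) ⟩
      p !                                       ∎)) (m∣m*n (n !))
      where open ≡-Reasoning
  ... | inj₁ p∣pCk = p∣pCk
  ... | inj₂ p∣k!*[p-k]! with euclidsLemma (k !) ((p ∸ k) !) p-prime p∣k!*[p-k]!
  ...   | inj₁ p∣k!     = contradiction p∣k! (prime∤factorial p-prime k<p)
  ...   | inj₂ p∣[p-k]! = contradiction p∣[p-k]! (prime∤factorial p-prime (∸-monoʳ-< 0<k (<⇒≤ k<p)))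

module CharacteristicProperties {c ℓ} (R : CommutativeRing c ℓ) where
  open CommutativeRing R hiding (zero)
  open import Algebra.Properties.Semiring.Mult semiring
  open import Algebra.Properties.Semiring.Exp semiring
  open import Algebra.Properties.Semiring.Sum semiring using (sum; sum-init-last; sum-cong-≋; sum-replicate; sum-replicate-zero)
  open import Algebra.Properties.CommutativeSemiring.Binomial commutativeSemiring
  open import Relation.Binary.Reasoning.Setoid setoid

  ×1-homo-^ : ∀ m n → (m ℕ.^ n) × 1# ≈ (m × 1#) ^ n
  ×1-homo-^ m zero    = +-identityʳ 1#
  ×1-homo-^ m (suc n) = trans (×1-homo-* m (m ℕ.^ n)) (*-congˡ (×1-homo-^ m n))

  module _ (x y : Carrier) where

    binomialTerm-last : ∀ n → binomialTerm x y n (Fin.fromℕ n) ≈ x ^ n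
    binomialTerm-last n rewrite Fin.toℕ-fromℕ n | nCn≡1 n | ℕ.n∸n≡0 n =
      trans (+-identityʳ _) (*-identityʳ _)

    ^-distrib-+-if-binomials-vanish : ∀ n → 0 ℕ.< n →
      (∀ k → 0 ℕ.< k → k ℕ.< n → ∀ z → (n C k) × z ≈ 0#) →
      (x + y) ^ n ≈ x ^ n + y ^ n
    ^-distrib-+-if-binomials-vanish (suc m) _ vanish = begin
      (x + y) ^ suc m                            ≈⟨ theorem (suc m) x y ⟩
      t zero + sum (t ∘ suc)                     ≈⟨ +-congˡ (sum-init-last (t ∘ suc)) ⟩
      t zero + (sum (t ∘ suc ∘ Fin.inject₁) + t (suc (Fin.fromℕ m)))
                                                 ≈⟨ +-congˡ (+-congʳ (trans (sum-cong-≋ middle) (sum-replicate-zero m))) ⟩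
      t zero + (0# + t (Fin.fromℕ (suc m)))      ≈⟨ +-cong (trans (+-identityʳ _) (*-identityˡ _)) (+-identityˡ _) ⟩
      y ^ suc m + t (Fin.fromℕ (suc m))          ≈⟨ +-congˡ (binomialTerm-last (suc m)) ⟩
      y ^ suc m + x ^ suc m                      ≈⟨ +-comm _ _ ⟩
      x ^ suc m + y ^ suc m                      ∎
      where
      t = binomialTerm x y (suc m)
      middle : ∀ (i : Fin m) → t (suc (Fin.inject₁ i)) ≈ 0#
      middle i = vanish _ (ℕ.s≤s ℕ.z≤n)
        (ℕ.s≤s (≡.subst (ℕ._< m) (≡.sym (Fin.toℕ-inject₁ i)) (Fin.toℕ<n i))) _

  module _ {p} (p-prime : Prime p) (char-p : p × 1# ≈ 0#) where

    ∣char⇒×≈0 : ∀ {n} → p ∣ n → ∀ x → n × x ≈ 0#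
    ∣char⇒×≈0 (divides m ≡.refl) x = begin
      (m ℕ.* p) × x      ≈⟨ ×-assocˡ x m p ⟨
      m × (p × x)        ≈⟨ ×-congʳ m (×-congʳ p (*-identityˡ x)) ⟨
      m × (p × (1# * x)) ≈⟨ ×-congʳ m (×-assoc-* p 1# x) ⟨
      m × ((p × 1#) * x) ≈⟨ ×-congʳ m (trans (*-congʳ char-p) (zeroˡ x)) ⟩
      m × 0#             ≈⟨ sum-replicate m ⟨
      sum {m} (λ _ → 0#) ≈⟨ sum-replicate-zero m ⟩
      0#                 ∎

    ^p-distrib-+ : ∀ x y → (x + y) ^ p ≈ x ^ p + y ^ p
    ^p-distrib-+ x y = ^-distrib-+-if-binomials-vanish x y p (ℕ.<-trans ℕ.z<s (prime⇒1<p p-prime))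
      (λ k 0<k k<p → ∣char⇒×≈0 (prime∣binomial p-prime 0<k k<p))

    ^[p^j]-distrib-+ : ∀ j x y → (x + y) ^ (p ℕ.^ j) ≈ x ^ (p ℕ.^ j) + y ^ (p ℕ.^ j)
    ^[p^j]-distrib-+ zero    x y = distribʳ 1# x y
    ^[p^j]-distrib-+ (suc j) x y = begin
      (x + y) ^ (p ℕ.* p ℕ.^ j)                 ≈⟨ ^-assocʳ (x + y) p (p ℕ.^ j) ⟨
      ((x + y) ^ p) ^ (p ℕ.^ j)                 ≈⟨ ^-congˡ (p ℕ.^ j) (^p-distrib-+ x y) ⟩
      (x ^ p + y ^ p) ^ (p ℕ.^ j)               ≈⟨ ^[p^j]-distrib-+ j (x ^ p) (y ^ p) ⟩
      (x ^ p) ^ (p ℕ.^ j) + (y ^ p) ^ (p ℕ.^ j) ≈⟨ +-cong (^-assocʳ x p (p ℕ.^ j)) (^-assocʳ y p (p ℕ.^ j)) ⟩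
      x ^ (p ℕ.* p ℕ.^ j) + y ^ (p ℕ.* p ℕ.^ j) ∎

module FiniteFieldProperties {c ℓ} (F : FiniteField c ℓ) where
  open FiniteField F hiding (zero)
  open FieldOps F
  open import Algebra.Properties.Semiring.Exp semiring using (_^_)
  open import Algebra.Properties.Semiring.Mult semiring using (_×_)
  open import Algebra.Properties.Group +-group using (identityˡ-unique; \\-leftDividesˡ; \\-leftDividesʳ)
  open Sum +-commutativeMonoid using (∑-distrib-+; sum-replicate) renaming (sum to ∑)
  open Sum *-commutativeMonoid using ()
    renaming (sum to ∏; sum-remove to ∏-remove; sum-cong-≋ to ∏-cong-≋; sum-replicate to ∏-replicate; sum-replicate-zero to ∏-replicate-1; ∑-distrib-+ to ∏-distrib-*)
  open import Relation.Binary.Reasoning.Setoid setoid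

  module _ {x : Carrier} (x≉0 : ¬ (x ≈ 0#)) where
    x⁻¹ : Carrier
    x⁻¹ = proj₁ (inverse x x≉0)

    x⁻¹*x≈1 : x⁻¹ * x ≈ 1#
    x⁻¹*x≈1 = trans (*-comm x⁻¹ x) (proj₂ (inverse x x≉0))

    x*[x⁻¹*y]≈y : ∀ y → x * (x⁻¹ * y) ≈ y
    x*[x⁻¹*y]≈y y = begin
      x * (x⁻¹ * y)  ≈⟨ *-assoc x x⁻¹ y ⟨
      (x * x⁻¹) * y  ≈⟨ *-congʳ (proj₂ (inverse x x≉0)) ⟩
      1# * y         ≈⟨ *-identityˡ y ⟩
      y              ∎

    x⁻¹*[x*y]≈y : ∀ y → x⁻¹ * (x * y) ≈ y
    x⁻¹*[x*y]≈y y = begin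
      x⁻¹ * (x * y)  ≈⟨ *-assoc x⁻¹ x y ⟨
      (x⁻¹ * x) * y  ≈⟨ *-congʳ x⁻¹*x≈1 ⟩
      1# * y         ≈⟨ *-identityˡ y ⟩
      y              ∎

    *-cancelˡ : ∀ {y z} → x * y ≈ x * z → y ≈ z
    *-cancelˡ {y} {z} xy≈xz =
      trans (sym (x⁻¹*[x*y]≈y y)) (trans (*-congˡ xy≈xz) (x⁻¹*[x*y]≈y z))

  x*y≈0⇒x≈0⊎y≈0 : ∀ {x y} → x * y ≈ 0# → x ≈ 0# ⊎ y ≈ 0#
  x*y≈0⇒x≈0⊎y≈0 {x} {y} xy≈0 with x ≟ 0#
  ... | yes x≈0 = inj₁ x≈0
  ... | no x≉0  = inj₂ (*-cancelˡ x≉0 (trans xy≈0 (sym (zeroʳ x))))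

  pow≡^ : ∀ x n → pow x n ≡.≡ x ^ n
  pow≡^ x zero    = ≡.refl
  pow≡^ x (suc n) = ≡.cong (x *_) (pow≡^ x n)

  ^≈0⇒≈0 : ∀ {x} n → x ^ n ≈ 0# → x ≈ 0#
  ^≈0⇒≈0 zero    1≈0  = contradiction (sym 1≈0) 0≉1
  ^≈0⇒≈0 (suc n) xxⁿ≈0 with x*y≈0⇒x≈0⊎y≈0 xxⁿ≈0
  ... | inj₁ x≈0  = x≈0
  ... | inj₂ xⁿ≈0 = ^≈0⇒≈0 n xⁿ≈0

  index : Carrier → Fin size
  index x = proj₁ (enum-surj x)

  enum-index : ∀ x → enum (index x) ≈ x
  enum-index x = proj₂ (enum-surj x)

  module _ (h h⁻¹ : Carrier → Carrier)
           (h-cong : ∀ {x y} → x ≈ y → h x ≈ h y) (h⁻¹-cong : ∀ {x y} → x ≈ y → h⁻¹ x ≈ h⁻¹ y)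
           (h∘h⁻¹ : ∀ x → h (h⁻¹ x) ≈ x) (h⁻¹∘h : ∀ x → h⁻¹ (h x) ≈ x) where

    private
      along : (Carrier → Carrier) → Fin size → Fin size
      along f = index ∘ f ∘ enum

      along-inverse : ∀ {f g} → (∀ {x y} → x ≈ y → f x ≈ f y) → (∀ x → f (g x) ≈ x) →
                      ∀ i → along f (along g i) ≡.≡ i
      along-inverse f-cong f∘g i =
        enum-inj _ _ (trans (enum-index _) (trans (f-cong (enum-index _)) (f∘g (enum i))))

    enum-permutation : Permutation size size
    enum-permutation = permutation (along h) (along h⁻¹)
      (along-inverse h-cong h∘h⁻¹) (along-inverse h⁻¹-cong h⁻¹∘h)

    module _ {m ℓm} (M : CommutativeMonoid m ℓm) where
      open CommutativeMonoid M using () renaming (Carrier to A; _≈_ to _≈ᴹ_; trans to transᴹ)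
      open Sum M using (sum; ∑-permute; sum-cong-≋)

      ∑-reindex : (g : Carrier → A) → (∀ {x y} → x ≈ y → g x ≈ᴹ g y) →
                  sum (g ∘ enum) ≈ᴹ sum (g ∘ h ∘ enum)
      ∑-reindex g g-cong = transᴹ (∑-permute (g ∘ enum) enum-permutation)
        (sum-cong-≋ (λ i → g-cong (enum-index (h (enum i)))))

  size×1≈0 : size × 1# ≈ 0#
  size×1≈0 = identityˡ-unique (size × 1#) (∑ enum) (begin
    size × 1# + ∑ enum            ≈⟨ +-congʳ (sum-replicate size) ⟨
    ∑ {size} (λ _ → 1#) + ∑ enum  ≈⟨ ∑-distrib-+ (λ _ → 1#) enum ⟨
    ∑ (λ i → 1# + enum i)         ≈⟨ ∑-reindex (1# +_) ((- 1#) +_) +-congˡ +-congˡ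
                                       (\\-leftDividesˡ 1#) (\\-leftDividesʳ 1#) +-commutativeMonoid id id ⟨
    ∑ enum                        ∎)

  ∏-one-point : ∀ {n} x (t : Fin n → Carrier) (z : Fin n) → t z ≈ 1# →
                (∀ i → i ≡.≢ z → t i ≈ x) → ∏ t * x ≈ x ^ n
  ∏-one-point {suc m} x t z tz≈1 t≈x = begin
    ∏ t * x                        ≈⟨ *-congʳ (∏-remove t) ⟩
    (t z * ∏ (t ∘ Fin.punchIn z)) * x
      ≈⟨ *-congʳ (*-cong tz≈1 (trans (∏-cong-≋ (λ j → t≈x _ (Fin.punchInᵢ≢i z j))) (∏-replicate m))) ⟩
    (1# * x ^ m) * x               ≈⟨ trans (*-congʳ (*-identityˡ _)) (*-comm _ _) ⟩
    x ^ suc m                      ∎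

  zero↦one : Carrier → Carrier
  zero↦one e with e ≟ 0#
  ... | yes _ = 1#
  ... | no _  = e

  zero↦one-cong : ∀ {d e} → d ≈ e → zero↦one d ≈ zero↦one e
  zero↦one-cong {d} {e} d≈e with d ≟ 0# | e ≟ 0#
  ... | yes _   | yes _   = refl
  ... | yes d≈0 | no e≉0  = contradiction (trans (sym d≈e) d≈0) e≉0
  ... | no d≉0  | yes e≈0 = contradiction (trans d≈e e≈0) d≉0
  ... | no _    | no _    = d≈e

  zero↦one≉0 : ∀ e → ¬ (zero↦one e ≈ 0#)
  zero↦one≉0 e with e ≟ 0#
  ... | yes _  = λ 1≈0 → 0≉1 (sym 1≈0)
  ... | no e≉0 = e≉0

  ∏≉0 : ∀ {n} (t : Fin n → Carrier) → (∀ i → ¬ (t i ≈ 0#)) → ¬ (∏ t ≈ 0#)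
  ∏≉0 {zero}  t t≉0 1≈0 = 0≉1 (sym 1≈0)
  ∏≉0 {suc n} t t≉0 ∏t≈0 with x*y≈0⇒x≈0⊎y≈0 ∏t≈0
  ... | inj₁ t₀≈0 = t≉0 zero t₀≈0
  ... | inj₂ ∏≈0  = ∏≉0 (t ∘ suc) (t≉0 ∘ suc) ∏≈0

  -- Scaling by x ≉ 0 permutes F and multiplies zero↦one by x away from 0, so cancelling the
  -- nonzero product of zero↦one over F shows that x ^ (size - 1) ≈ 1.
  module _ (x : Carrier) where
    private
      x-unless-0 : Carrier → Carrier
      x-unless-0 e with e ≟ 0#
      ... | yes _ = 1#
      ... | no _  = x

      zero↦one-* : ¬ (x ≈ 0#) → ∀ e → zero↦one (x * e) ≈ x-unless-0 e * zero↦one e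
      zero↦one-* x≉0 e with e ≟ 0# | (x * e) ≟ 0#
      ... | yes _   | yes _    = sym (*-identityˡ 1#)
      ... | yes e≈0 | no xe≉0  = contradiction (trans (*-congˡ e≈0) (zeroʳ x)) xe≉0
      ... | no e≉0  | yes xe≈0 = contradiction (x*y≈0⇒x≈0⊎y≈0 xe≈0) [ x≉0 , e≉0 ]
      ... | no _    | no _     = refl

      ∏x-unless-0≈1 : ¬ (x ≈ 0#) → ∏ (x-unless-0 ∘ enum) ≈ 1#
      ∏x-unless-0≈1 x≉0 = *-cancelˡ (∏≉0 (zero↦one ∘ enum) (zero↦one≉0 ∘ enum)) (begin
        Φ * ∏ (x-unless-0 ∘ enum)  ≈⟨ *-comm _ _ ⟩
        ∏ (x-unless-0 ∘ enum) * Φ  ≈⟨ ∏-distrib-* (x-unless-0 ∘ enum) (zero↦one ∘ enum) ⟨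
        ∏ (λ i → x-unless-0 (enum i) * zero↦one (enum i))
                                   ≈⟨ ∏-cong-≋ (λ i → zero↦one-* x≉0 (enum i)) ⟨
        ∏ (λ i → zero↦one (x * enum i))
                                   ≈⟨ ∑-reindex (x *_) (x⁻¹ x≉0 *_) *-congˡ *-congˡ (x*[x⁻¹*y]≈y x≉0)
                                        (x⁻¹*[x*y]≈y x≉0) *-commutativeMonoid zero↦one zero↦one-cong ⟨
        Φ                          ≈⟨ *-identityʳ Φ ⟨
        Φ * 1#                     ∎)
        where
        Φ = ∏ (zero↦one ∘ enum)

      x-unless-0-enum : ∀ i → i ≡.≢ index 0# → x-unless-0 (enum i) ≈ x
      x-unless-0-enum i i≢i₀ with enum i ≟ 0#
      ... | yes eᵢ≈0 = contradiction (enum-inj _ _ (trans eᵢ≈0 (sym (enum-index 0#)))) i≢i₀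
      ... | no _     = refl

      x-unless-0-at-0 : x-unless-0 (enum (index 0#)) ≈ 1#
      x-unless-0-at-0 with enum (index 0#) ≟ 0#
      ... | yes _   = refl
      ... | no e₀≉0 = contradiction (enum-index 0#) e₀≉0

    ^size≈id : x ^ size ≈ x
    ^size≈id = begin
      x ^ size                    ≈⟨ ∏-one-point x (x-unless-0 ∘ enum) (index 0#) x-unless-0-at-0 x-unless-0-enum ⟨
      ∏ (x-unless-0 ∘ enum) * x   ≈⟨ ∏*x≈x ⟩
      x                           ∎
      where
      ∏*x≈x : ∏ (x-unless-0 ∘ enum) * x ≈ x
      ∏*x≈x with x ≟ 0#
      ... | yes x≈0 = trans (*-congˡ x≈0) (trans (zeroʳ _) (sym x≈0))
      ... | no x≉0  = trans (*-congʳ (∏x-unless-0≈1 x≉0)) (*-identityˡ x)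

  χ-resp : ∀ {x y} → (x ≈ 0# ⇔ y ≈ 0#) → (IsSquare x ⇔ IsSquare y) → χ x ≡.≡ χ y
  χ-resp {x} {y} zero⇔ square⇔ with x ≟ 0# | y ≟ 0#
  ... | yes _   | yes _   = ≡.refl
  ... | yes x≈0 | no y≉0  = contradiction (Equivalence.to zero⇔ x≈0) y≉0
  ... | no x≉0  | yes y≈0 = contradiction (Equivalence.from zero⇔ y≈0) x≉0
  ... | no _    | no _ with isSquare? x | isSquare? y
  ...   | yes _  | yes _  = ≡.refl
  ...   | yes □x | no ¬□y = contradiction (Equivalence.to square⇔ □x) ¬□y
  ...   | no ¬□x | yes □y = contradiction (Equivalence.from square⇔ □y) ¬□x
  ...   | no _   | no _   = ≡.refl

  χ-cong : ∀ {x y} → x ≈ y → χ x ≡.≡ χ y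
  χ-cong x≈y = χ-resp (mk⇔ (trans (sym x≈y)) (trans x≈y))
    (mk⇔ (λ (w , w²≈x) → w , trans w²≈x x≈y) (λ (w , w²≈y) → w , trans w²≈y (sym x≈y)))

  χ≡0⇒≈0 : ∀ {x} → χ x ≡.≡ 0ℤ → x ≈ 0#
  χ≡0⇒≈0 {x} χx≡0 with x ≟ 0#
  ... | yes x≈0 = x≈0
  ... | no _ with isSquare? x
  χ≡0⇒≈0 () | no _ | yes _
  χ≡0⇒≈0 () | no _ | no _

  χ-invariant : (f : Carrier → Carrier) → (∀ {x y} → x ≈ y → f x ≈ f y) →
                (∀ x y → f (x * y) ≈ f x * f y) → f 0# ≈ 0# → (∀ x → f (f x) ≈ x) →
                ∀ x → χ (f x) ≡.≡ χ x
  χ-invariant f f-cong f-* f-0 f-involutive x = χ-resp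
    (mk⇔ (λ fx≈0 → trans (sym (f-involutive x)) (trans (f-cong fx≈0) f-0)) (λ x≈0 → trans (f-cong x≈0) f-0))
    (mk⇔ (λ (w , w²≈fx) → f w , trans (sym (f-* w w)) (trans (f-cong w²≈fx) (f-involutive x)))
         (λ (w , w²≈x) → f w , trans (sym (f-* w w)) (f-cong w²≈x)))

  nearMul-congˡ : ∀ q {d e} c → d ≈ e → nearMul q d c ≈ nearMul q e c
  nearMul-congˡ q {d} {e} c d≈e with χ d ≟ℤ -1ℤ | χ e ≟ℤ -1ℤ
  ... | yes _      | yes _      = *-congʳ d≈e
  ... | no _       | no _       = *-congʳ d≈e
  ... | yes χd≡-1  | no χe≢-1   = contradiction (≡.trans (≡.sym (χ-cong d≈e)) χd≡-1) χe≢-1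
  ... | no χd≢-1   | yes χe≡-1  = contradiction (≡.trans (χ-cong d≈e) χe≡-1) χd≢-1

  Admissible-sym : ∀ {a b} → Admissible a b → Admissible b a
  Admissible-sym (χa≡χb , χa≢0 , χ[1-a]≡χ[1-b] , χ[1-a]≢0) =
    ≡.sym χa≡χb , χa≢0 ∘ ≡.trans χa≡χb , ≡.sym χ[1-a]≡χ[1-b] , χ[1-a]≢0 ∘ ≡.trans χ[1-a]≡χ[1-b]

  Qop≈starOp : ∀ q {a b} → b ≈ pow a q → SameOp (Qop a b) (starOp q a)
  Qop≈starOp q {a} b≈aᵍ x y with χ (y - x) ≟ℤ -1ℤ
  ... | yes _ = +-congˡ (trans (*-congʳ b≈aᵍ) (*-comm _ _))
  ... | no _  = +-congˡ (*-comm a (y - x))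

  module Frobenius {p} (p-prime : Prime p) (k : ℕ) (size≡q² : size ≡.≡ p ℕ.^ k ℕ.* p ℕ.^ k) where
    open CharacteristicProperties commRing using (×1-homo-^; ^[p^j]-distrib-+)
    open import Algebra.Properties.Semiring.Exp semiring using (^-congˡ; ^-assocʳ)
    open import Algebra.Properties.CommutativeSemiring.Exp commutativeSemiring using (^-distrib-*)
    open import Algebra.Properties.Group +-group using (identityʳ-unique; inverseˡ-unique; x∙y⁻¹≈ε⇒x≈y)

    q : ℕ
    q = p ℕ.^ k

    char-p : p × 1# ≈ 0#
    char-p = ^≈0⇒≈0 (k ℕ.+ k) (begin
      (p × 1#) ^ (k ℕ.+ k)   ≈⟨ ×1-homo-^ p (k ℕ.+ k) ⟨
      (p ℕ.^ (k ℕ.+ k)) × 1# ≡⟨ ≡.cong (_× 1#) (≡.trans (ℕ.^-distribˡ-+-* p k k) (≡.sym size≡q²)) ⟩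
      size × 1#              ≈⟨ size×1≈0 ⟩
      0#                     ∎)

    frob-cong : ∀ {x y} → x ≈ y → pow x q ≈ pow y q
    frob-cong {x} {y} x≈y rewrite pow≡^ x q | pow≡^ y q = ^-congˡ q x≈y

    frob-+ : ∀ x y → pow (x + y) q ≈ pow x q + pow y q
    frob-+ x y rewrite pow≡^ (x + y) q | pow≡^ x q | pow≡^ y q =
      ^[p^j]-distrib-+ p-prime char-p k x y

    frob-* : ∀ x y → pow (x * y) q ≈ pow x q * pow y q
    frob-* x y rewrite pow≡^ (x * y) q | pow≡^ x q | pow≡^ y q = ^-distrib-* x y q

    frob-involutive : ∀ x → pow (pow x q) q ≈ x
    frob-involutive x rewrite pow≡^ (pow x q) q | pow≡^ x q = begin
      (x ^ q) ^ q      ≈⟨ ^-assocʳ x q q ⟩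
      x ^ (q ℕ.* q)    ≡⟨ ≡.cong (x ^_) size≡q² ⟨
      x ^ size         ≈⟨ ^size≈id x ⟩
      x                ∎

    frob-0 : pow 0# q ≈ 0#
    frob-0 = identityʳ-unique (pow 0# q) (pow 0# q)
      (trans (sym (frob-+ 0# 0#)) (frob-cong (+-identityʳ 0#)))

    frob-1 : pow 1# q ≈ 1#
    frob-1 rewrite pow≡^ 1# q = trans (sym (∏-replicate q)) (∏-replicate-1 q)

    frob-sub : ∀ x y → pow (x - y) q ≈ pow x q - pow y q
    frob-sub x y = trans (frob-+ x (- y)) (+-congˡ (inverseˡ-unique (pow (- y) q) (pow y q)
      (trans (sym (frob-+ (- y) y)) (trans (frob-cong (-‿inverseˡ y)) frob-0))))

    χ-frob : ∀ x → χ (pow x q) ≡.≡ χ x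
    χ-frob = χ-invariant (λ x → pow x q) frob-cong frob-* frob-0 frob-involutive

    nearMul-frob : ∀ d c → pow (nearMul q d c) q ≈ nearMul q (pow d q) (pow c q)
    nearMul-frob d c with χ d ≟ℤ -1ℤ | χ (pow d q) ≟ℤ -1ℤ
    ... | yes _      | yes _      = frob-* d (pow c q)
    ... | no _       | no _       = frob-* d c
    ... | yes χd≡-1  | no χdᵍ≢-1  = contradiction (≡.trans (χ-frob d) χd≡-1) χdᵍ≢-1
    ... | no χd≢-1   | yes χdᵍ≡-1 = contradiction (≡.trans (≡.sym (χ-frob d)) χdᵍ≡-1) χd≢-1

    frob-starOp : ∀ a x y → pow (starOp q a x y) q ≈ starOp q (pow a q) (pow x q) (pow y q)
    frob-starOp a x y = begin
      pow (x + nearMul q (y - x) a) q                    ≈⟨ frob-+ x _ ⟩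
      pow x q + pow (nearMul q (y - x) a) q              ≈⟨ +-congˡ (nearMul-frob (y - x) a) ⟩
      pow x q + nearMul q (pow (y - x) q) (pow a q)      ≈⟨ +-congˡ (nearMul-congˡ q (pow a q) (frob-sub y x)) ⟩
      pow x q + nearMul q (pow y q - pow x q) (pow a q)  ∎

    frob-isomorphism : ∀ a → IsIsomorphism (λ x → pow x q) (starOp q a) (starOp q (pow a q))
    frob-isomorphism a =
        (λ _ _ → frob-cong)
      , (λ x y xᵍ≈yᵍ → trans (sym (frob-involutive x)) (trans (frob-cong xᵍ≈yᵍ) (frob-involutive y)))
      , (λ y → pow y q , frob-involutive y)
      , frob-starOp a

    admissible-frob : ∀ {a} → ¬ (a ≈ 0#) → ¬ (a ≈ 1#) → Admissible a (pow a q)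
    admissible-frob {a} a≉0 a≉1 =
        ≡.sym (χ-frob a)
      , a≉0 ∘ χ≡0⇒≈0
      , ≡.trans (≡.sym (χ-frob (1# - a))) (χ-cong (trans (frob-sub 1# a) (+-congʳ frob-1)))
      , λ χ[1-a]≡0 → a≉1 (sym (x∙y⁻¹≈ε⇒x≈y 1# a (χ≡0⇒≈0 χ[1-a]≡0)))

open import Data.Nat using (_*_)
open import Data.Product using (_×_)
open import Relation.Binary.PropositionalEquality using (_≡_)

proposition1p4 : ∀ {c ℓ} (F : FiniteField c ℓ) (q : ℕ) → OddPrimePower q → FiniteField.size F ≡ q * q →
    let open FiniteField F in let open FieldOps F in
    (a : Carrier) → ¬ (a ≈ 0#) → ¬ (a ≈ 1#) →
    Admissible a (pow a q) × Admissible (pow a q) a ×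
    SameOp (Qop a (pow a q)) (starOp q a) ×
    SameOp (Qop (pow a q) a) (starOp q (pow a q)) ×
    IsIsomorphism (λ x → pow x q) (starOp q a) (starOp q (pow a q))
proposition1p4 F q (p , k , p-prime , _ , _ , ≡.refl) size≡q² a a≉0 a≉1 =
    admissible-frob a≉0 a≉1
  , Admissible-sym (admissible-frob a≉0 a≉1)
  , Qop≈starOp q refl
  , Qop≈starOp q (sym (frob-involutive a))
  , frob-isomorphism a
  where
  open FiniteField F
  open FiniteFieldProperties F
  open Frobenius p-prime k size≡q² hiding (q)
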